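{- Let $\mathcal{C}$ be a neural code on $n$ neurons and let $\Delta(\mathcal{C})=\{\alpha\subseteq[n]\mid \alpha\subseteq\beta \text{ for some } \beta\in\mathcal{C}\}$. If for every pair $\sigma,\tau\in\mathcal{C}$ we have $\sigma\cup\tau\in\Delta(\mathcal{C})$, then the codeword containment graph $G_\mathcal{C}$ is connected.
   Context: A neural code on $n$ neurons is a collection of subsets of $[n]=\{1,\dots,n\}$ (its elements are called codewords). The codeword containment graph $G_\mathcal{C}$ of a code $\mathcal{C}$ is the undirected simple graph whose vertex set is $\mathcal{C}$ and in which $\sigma,\tau\in\mathcal{C}$ are adjacent if and only if $\sigma\subsetneq\tau$ or $\tau\subsetneq\sigma$. -}

module Defs where

open import Data.Nat using (ℕ)
open import Data.Fin.Subset using (Subset; _⊆_; _⊂_; _∪_)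
open import Data.Product using (Σ; _×_)
open import Data.Sum using (_⊎_)

-- A neural code on n neurons: a collection of subsets of [n] = Fin n.
-- Since Subset n is finite, a code is given as a membership predicate.
Code : ℕ → Set₁
Code n = Subset n → Set

Δ : ∀ {n} → Code n → Code n
Δ {n} C α = Σ (Subset n) (λ β → C β × α ⊆ β)

Adjacent : ∀ {n} → Subset n → Subset n → Set
Adjacent σ τ = σ ⊂ τ ⊎ τ ⊂ σ

data Walk {n : ℕ} (C : Code n) : Subset n → Subset n → Set where
  [] : ∀ {σ} → C σ → Walk C σ σ
  _∷_ : ∀ {σ ρ τ} → C σ × Adjacent σ ρ → Walk C ρ τ → Walk C σ τ

ContainmentGraphConnected : ∀ {n} → Code n → Set
ContainmentGraphConnected C = ∀ σ τ → C σ → C τ → Walk C σ τ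

-- Any two codewords σ, τ lie below a common codeword β, since σ ∪ τ ∈ Δ(C).
-- Containment then gives the walk σ — β — τ in G_C, where an edge collapses
-- whenever the containment is an equality.
module Submission where

open import Defs
open import Data.Nat using (ℕ)
open import Data.Fin.Subset using (Subset; _∪_; _⊆_; _⊂_)
open import Data.Fin.Subset.Properties using (_∈?_; ⊆-antisym; p⊆p∪q; q⊆p∪q)
open import Data.Fin.Properties using (any?)
open import Data.Product using (_,_)
open import Data.Sum using (_⊎_; inj₁; inj₂)
open import Relation.Nullary using (yes; no; ¬?)
open import Relation.Nullary.Decidable using (_×-dec_)
open import Relation.Binary.PropositionalEquality using (_≡_; refl)
open import Data.Empty using (⊥-elim)

⊆⇒⊂⊎≡ : ∀ {n} {p q : Subset n} → p ⊆ q → p ⊂ q ⊎ p ≡ q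
⊆⇒⊂⊎≡ {p = p} {q} p⊆q with any? (λ x → (x ∈? q) ×-dec ¬? (x ∈? p))
... | yes witness = inj₁ (p⊆q , witness)
... | no ¬witness = inj₂ (⊆-antisym p⊆q q⊆p)
  where
  q⊆p : q ⊆ p
  q⊆p {x} x∈q with x ∈? p
  ... | yes x∈p = x∈p
  ... | no  x∉p = ⊥-elim (¬witness (x , x∈q , x∉p))

module _ {n : ℕ} {C : Code n} where

  walk-⊇ : ∀ {β τ} → C β → C τ → τ ⊆ β → Walk C β τ
  walk-⊇ cβ cτ τ⊆β with ⊆⇒⊂⊎≡ τ⊆β
  ... | inj₁ τ⊂β = (cβ , inj₂ τ⊂β) ∷ [] cτ
  ... | inj₂ refl = [] cτ

  walk-⊆-∷ : ∀ {σ β τ} → C σ → σ ⊆ β → Walk C β τ → Walk C σ τ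
  walk-⊆-∷ cσ σ⊆β w with ⊆⇒⊂⊎≡ σ⊆β
  ... | inj₁ σ⊂β = (cσ , inj₁ σ⊂β) ∷ w
  ... | inj₂ refl = w

  walk-via-upper-bound : ∀ {σ β τ} → C σ → C β → C τ
                       → σ ⊆ β → τ ⊆ β → Walk C σ τ
  walk-via-upper-bound cσ cβ cτ σ⊆β τ⊆β = walk-⊆-∷ cσ σ⊆β (walk-⊇ cβ cτ τ⊆β)

mainTheorem1 : (n : ℕ) (C : Code n)
    → (∀ σ τ → C σ → C τ → Δ C (σ ∪ τ))
    → ContainmentGraphConnected C
mainTheorem1 n C unionsInΔ σ τ cσ cτ with unionsInΔ σ τ cσ cτ
... | β , cβ , σ∪τ⊆β =
  walk-via-upper-bound cσ cβ cτ (λ x → σ∪τ⊆β (p⊆p∪q τ x)) (λ x → σ∪τ⊆β (q⊆p∪q σ τ x))
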